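{- If $a\in\mathcal{C}_{rec}$, then for every total function $f\colon\mathbb N\to\mathbb N$ the sequence $a(f)$ is finite, i.e. $a(f)\in\mathbb N^{<\mathbb N}$.
   Context: Let $\{e\}$ denote the $e$-th partial recursive function in a standard numbering. Proof system (Tait one-sided calculus for first-order arithmetic): language $0,1,+,\times,=$; formulas in negation normal form built from literals by $\land,\lor,\forall,\exists$; $\neg C$ is the negation normal form of the negation of $C$. Sequents are finite sets of sentences; $\Gamma,A$ means $\Gamma\cup\{A\}$; axioms are $\Gamma,A$ with $A$ a closed true literal; $\bar n$ is the numeral for $n$. Fix a primitive recursive Gödel numbering of formulas, sequents and tuples $\langle\cdot\rangle$, $(a)_i$ the $i$-th component; $\mathbb N^{<\mathbb N}$ denotes the finite sequences of naturals. Define $\mathrm{End}(\langle\mathrm{Ax},\Gamma\rangle)=\Gamma$, $\mathrm{End}(a)=(a)_1$ if $(a)_0=\mathrm{cut}$, and $\mathrm{End}(a)=(a)_1\cup\{(a)_2\}$ otherwise. $\mathcal{C}_{rec}$ is the smallest subset of $\mathbb N$ such that: $\langle\mathrm{Ax},\Gamma\rangle\in\mathcal{C}_{rec}$ for every axiom $\Gamma$; if $a,b\in\mathcal{C}_{rec}$, $\mathrm{End}(a)=\Gamma,A$, $\mathrm{End}(b)=\Gamma,B$ then $\langle\land,\Gamma,A\land B,a,b\rangle\in\mathcal{C}_{rec}$; if $a\in\mathcal{C}_{rec}$, $\mathrm{End}(a)=\Gamma,A,B$ then $\langle\lor,\Gamma,A\lor B,a\rangle\in\mathcal{C}_{rec}$;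 if $\{e\}$ is total and for every $n$, $\{e\}(n)\in\mathcal{C}_{rec}$ with $\mathrm{End}(\{e\}(n))=\Gamma,A(\bar n)$, then $\langle\omega,\Gamma,\forall xA(x),e\rangle\in\mathcal{C}_{rec}$; if $a\in\mathcal{C}_{rec}$ and $\mathrm{End}(a)=\Gamma,A(\bar n)$ for some $n$ then $\langle\exists,\Gamma,\exists xA(x),a\rangle\in\mathcal{C}_{rec}$; if $a,b\in\mathcal{C}_{rec}$, $\mathrm{End}(a)=\Gamma,C$, $\mathrm{End}(b)=\Gamma,\neg C$ then $\langle\mathrm{cut},\Gamma,C,a,b\rangle\in\mathcal{C}_{rec}$. For $a\in\mathbb N$ and $f\colon\mathbb N\to\mathbb N$, $a(f)=\langle a_0,a_1,\ldots\rangle$ (a finite or infinite sequence) is defined by $a_0=a$ and for each $i$: if $a_i$ is $\langle\land,\Gamma,A\land B,b_0,b_1\rangle$ or $\langle\mathrm{cut},\Gamma,C,b_0,b_1\rangle$ then $a_{i+1}=b_{f(i)\bmod 2}$; if $a_i$ is $\langle\lor,\Gamma,A\lor B,b\rangle$ then $a_{i+1}=b$; if $a_i$ is $\langle\omega,\Gamma,\forall xA(x),e\rangle$ and $\{e\}(f(i))$ is defined then $a_{i+1}=\{e\}(f(i))$; otherwise $a_{i+1}$ is undefined and $a(f)=\langle a_0,\ldots,a_i\rangle$. -}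

module Defs where

open import Data.Nat using (ℕ; zero; suc; _+_; _*_; _∸_; _<_; _≡ᵇ_; _<ᵇ_; ⌊_/2⌋)
open import Data.Nat.DivMod using (_%_)
open import Data.Bool using (Bool; true; false; not; if_then_else_)
open import Data.List using (List; []; _∷_)
open import Data.Maybe using (Maybe; just; nothing)
open import Data.Product using (Σ; ∃; ∃-syntax; _×_; _,_)
open import Relation.Binary.PropositionalEquality using (_≡_; _≢_)
open import Relation.Nullary using (¬_)

-- Primitive recursive Gödel numbering of tuples
-- Cantor pairing  pair x y = T(x+y) + y  with  T k = k(k+1)/2,
-- tuples  ⟨⟩ = 0,  ⟨x, xs...⟩ = 1 + pair x ⟨xs...⟩.

tri : ℕ → ℕ
tri zero    = zero
tri (suc k) = suc k + tri k

pair : ℕ → ℕ → ℕ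
pair x y = tri (x + y) + y

tup : List ℕ → ℕ
tup []       = zero
tup (x ∷ xs) = suc (pair x (tup xs))

-- Finite sets of naturals (sequents), coded canonically: S ↦ Σ_{x∈S} 2^x.

odd : ℕ → Bool
odd zero    = false
odd (suc n) = not (odd n)

bit : ℕ → ℕ → Bool
bit zero    s = odd s
bit (suc x) s = bit x ⌊ s /2⌋

pow2 : ℕ → ℕ
pow2 zero    = 1
pow2 (suc n) = pow2 n + pow2 n

-- ins A Γ  is the code of  Γ ∪ {A}  (written  Γ,A  in the paper)
ins : ℕ → ℕ → ℕ
ins A Γ = if bit A Γ then Γ else Γ + pow2 A

-- Language 0,1,+,×,= ; formulas in negation normal form, de Bruijn variables

data Tm : Set where
  var  : ℕ → Tm
  zer  : Tm
  one  : Tm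
  plus : Tm → Tm → Tm
  mult : Tm → Tm → Tm

data Fm : Set where
  eq  : Tm → Tm → Fm
  neq : Tm → Tm → Fm
  and : Fm → Fm → Fm
  or  : Fm → Fm → Fm
  all : Fm → Fm
  ex  : Fm → Fm

data Literal : Fm → Set where
  lit-eq  : ∀ s t → Literal (eq s t)
  lit-neq : ∀ s t → Literal (neq s t)

ClosedTm : ℕ → Tm → Set
ClosedTm k (var i)    = i < k
ClosedTm k zer        = Data.Unit.⊤ where import Data.Unit
ClosedTm k one        = Data.Unit.⊤ where import Data.Unit
ClosedTm k (plus s t) = ClosedTm k s × ClosedTm k t
ClosedTm k (mult s t) = ClosedTm k s × ClosedTm k t

ClosedFm : ℕ → Fm → Set
ClosedFm k (eq s t)  = ClosedTm k s × ClosedTm k t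
ClosedFm k (neq s t) = ClosedTm k s × ClosedTm k t
ClosedFm k (and A B) = ClosedFm k A × ClosedFm k B
ClosedFm k (or A B)  = ClosedFm k A × ClosedFm k B
ClosedFm k (all A)   = ClosedFm (suc k) A
ClosedFm k (ex A)    = ClosedFm (suc k) A

Sentence : Fm → Set
Sentence = ClosedFm zero

num : ℕ → Tm
num zero    = zer
num (suc n) = plus (num n) one

-- substitution of a closed term u for variable k (variables above k shift down)
substTm : ℕ → Tm → Tm → Tm
substTm k u (var i) = if i ≡ᵇ k then u else (if k <ᵇ i then var (i ∸ 1) else var i)
substTm k u zer        = zer
substTm k u one        = one
substTm k u (plus s t) = plus (substTm k u s) (substTm k u t)
substTm k u (mult s t) = mult (substTm k u s) (substTm k u t)

substFm : ℕ → Tm → Fm → Fm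
substFm k u (eq s t)  = eq (substTm k u s) (substTm k u t)
substFm k u (neq s t) = neq (substTm k u s) (substTm k u t)
substFm k u (and A B) = and (substFm k u A) (substFm k u B)
substFm k u (or A B)  = or (substFm k u A) (substFm k u B)
substFm k u (all A)   = all (substFm (suc k) u A)
substFm k u (ex A)    = ex (substFm (suc k) u A)

inst : Fm → ℕ → Fm
inst A n = substFm zero (num n) A

neg : Fm → Fm
neg (eq s t)  = neq s t
neg (neq s t) = eq s t
neg (and A B) = or (neg A) (neg B)
neg (or A B)  = and (neg A) (neg B)
neg (all A)   = ex (neg A)
neg (ex A)    = all (neg A)

val : Tm → ℕ
val (var i)    = zero
val zer        = zero
val one        = 1
val (plus s t) = val s + val t
val (mult s t) = val s * val t

TrueLit : Fm → Set
TrueLit (eq s t)  = val s ≡ val t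
TrueLit (neq s t) = val s ≢ val t
TrueLit _         = Data.Empty.⊥ where import Data.Empty

codeTm : Tm → ℕ
codeTm (var i)    = tup (0 ∷ i ∷ [])
codeTm zer        = tup (1 ∷ [])
codeTm one        = tup (2 ∷ [])
codeTm (plus s t) = tup (3 ∷ codeTm s ∷ codeTm t ∷ [])
codeTm (mult s t) = tup (4 ∷ codeTm s ∷ codeTm t ∷ [])

⌜_⌝ : Fm → ℕ
⌜ eq s t ⌝  = tup (0 ∷ codeTm s ∷ codeTm t ∷ [])
⌜ neq s t ⌝ = tup (1 ∷ codeTm s ∷ codeTm t ∷ [])
⌜ and A B ⌝ = tup (2 ∷ ⌜ A ⌝ ∷ ⌜ B ⌝ ∷ [])
⌜ or A B ⌝  = tup (3 ∷ ⌜ A ⌝ ∷ ⌜ B ⌝ ∷ [])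
⌜ all A ⌝   = tup (4 ∷ ⌜ A ⌝ ∷ [])
⌜ ex A ⌝    = tup (5 ∷ ⌜ A ⌝ ∷ [])

IsSequent : ℕ → Set
IsSequent Γ = ∀ x → bit x Γ ≡ true → Σ Fm λ A → Sentence A × ⌜ A ⌝ ≡ x

IsAxiom : ℕ → Set
IsAxiom Δ = IsSequent Δ × Σ Fm λ A → Literal A × Sentence A × TrueLit A × bit ⌜ A ⌝ Δ ≡ true

data PR : Set where
  zeroF : PR
  succF : PR
  proj  : ℕ → PR
  comp  : PR → List PR → PR
  prec  : PR → PR → PR
  mu    : PR → PR

nth : List ℕ → ℕ → Maybe ℕ
nth []       _       = nothing
nth (x ∷ xs) zero    = just x
nth (x ∷ xs) (suc i) = nth xs i

mutual
  data Eval : PR → List ℕ → ℕ → Set where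
    ev-zero : ∀ {xs} → Eval zeroF xs 0
    ev-succ : ∀ {x xs} → Eval succF (x ∷ xs) (suc x)
    ev-proj : ∀ {i xs v} → nth xs i ≡ just v → Eval (proj i) xs v
    ev-comp : ∀ {f gs xs ys v} → EvalList gs xs ys → Eval f ys v → Eval (comp f gs) xs v
    ev-prec0 : ∀ {f g xs v} → Eval f xs v → Eval (prec f g) (0 ∷ xs) v
    ev-precS : ∀ {f g n xs r v} → Eval (prec f g) (n ∷ xs) r → Eval g (n ∷ r ∷ xs) v
             → Eval (prec f g) (suc n ∷ xs) v
    ev-mu : ∀ {f xs n} → Eval f (n ∷ xs) 0
          → (∀ m → m < n → Σ ℕ λ k → Eval f (m ∷ xs) (suc k))
          → Eval (mu f) xs n

  data EvalList : List PR → List ℕ → List ℕ → Set where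
    evl-[] : ∀ {xs} → EvalList [] xs []
    evl-∷  : ∀ {g gs xs y ys} → Eval g xs y → EvalList gs xs ys → EvalList (g ∷ gs) xs (y ∷ ys)

mutual
  codePR : PR → ℕ
  codePR zeroF      = tup (0 ∷ [])
  codePR succF      = tup (1 ∷ [])
  codePR (proj i)   = tup (2 ∷ i ∷ [])
  codePR (comp f gs) = tup (3 ∷ codePR f ∷ codePRs gs ∷ [])
  codePR (prec f g) = tup (4 ∷ codePR f ∷ codePR g ∷ [])
  codePR (mu f)     = tup (5 ∷ codePR f ∷ [])

  codePRs : List PR → ℕ
  codePRs []       = tup []
  codePRs (g ∷ gs) = tup (codePR g ∷ codePRs gs ∷ [])

_·_≃_ : ℕ → ℕ → ℕ → Set
e · n ≃ m = Σ PR λ p → codePR p ≡ e × Eval p (n ∷ []) m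

Total : ℕ → Set
Total e = ∀ n → ∃[ m ] (e · n ≃ m)

tAx tAnd tOr tω tEx tCut : ℕ
tAx = 0
tAnd = 1
tOr = 2
tω = 3
tEx = 4
tCut = 5

data End : ℕ → ℕ → Set where
  end-ax    : ∀ {Γ} → End (tup (tAx ∷ Γ ∷ [])) Γ
  end-cut   : ∀ {Γ rest} → End (tup (tCut ∷ Γ ∷ rest)) Γ
  end-other : ∀ {t Γ A rest} → t ≢ tCut → End (tup (t ∷ Γ ∷ A ∷ rest)) (ins A Γ)

data Crec : ℕ → Set where
  c-ax  : ∀ {Γ} → IsAxiom Γ → Crec (tup (tAx ∷ Γ ∷ []))
  c-and : ∀ {Γ A B a b} → Crec a → Crec b
        → End a (ins ⌜ A ⌝ Γ) → End b (ins ⌜ B ⌝ Γ)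
        → Crec (tup (tAnd ∷ Γ ∷ ⌜ and A B ⌝ ∷ a ∷ b ∷ []))
  c-or  : ∀ {Γ A B a} → Crec a → End a (ins ⌜ B ⌝ (ins ⌜ A ⌝ Γ))
        → Crec (tup (tOr ∷ Γ ∷ ⌜ or A B ⌝ ∷ a ∷ []))
  c-ω   : ∀ {Γ A e} → Total e
        → (∀ n m → e · n ≃ m → Crec m × End m (ins ⌜ inst A n ⌝ Γ))
        → Crec (tup (tω ∷ Γ ∷ ⌜ all A ⌝ ∷ e ∷ []))
  c-ex  : ∀ {Γ A a} n → Crec a → End a (ins ⌜ inst A n ⌝ Γ)
        → Crec (tup (tEx ∷ Γ ∷ ⌜ ex A ⌝ ∷ a ∷ []))
  c-cut : ∀ {Γ C a b} → Crec a → Crec b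
        → End a (ins ⌜ C ⌝ Γ) → End b (ins ⌜ neg C ⌝ Γ)
        → Crec (tup (tCut ∷ Γ ∷ ⌜ C ⌝ ∷ a ∷ b ∷ []))

-- The sequence a(f):  At a f i x  means  a_i = x  (a_i defined)

pick : ℕ → ℕ → ℕ → ℕ
pick k b₀ b₁ = if (k % 2) ≡ᵇ 0 then b₀ else b₁

data At (a : ℕ) (f : ℕ → ℕ) : ℕ → ℕ → Set where
  at-0    : At a f 0 a
  at-and  : ∀ {i Γ A B b₀ b₁} → At a f i (tup (tAnd ∷ Γ ∷ ⌜ and A B ⌝ ∷ b₀ ∷ b₁ ∷ []))
          → At a f (suc i) (pick (f i) b₀ b₁)
  at-cut  : ∀ {i Γ C b₀ b₁} → At a f i (tup (tCut ∷ Γ ∷ ⌜ C ⌝ ∷ b₀ ∷ b₁ ∷ []))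
          → At a f (suc i) (pick (f i) b₀ b₁)
  at-or   : ∀ {i Γ A B b} → At a f i (tup (tOr ∷ Γ ∷ ⌜ or A B ⌝ ∷ b ∷ []))
          → At a f (suc i) b
  at-ω    : ∀ {i Γ A e m} → At a f i (tup (tω ∷ Γ ∷ ⌜ all A ⌝ ∷ e ∷ []))
          → e · f i ≃ m → At a f (suc i) m

-- a(f) ∈ ℕ^{<ℕ}: some entry a_n is undefined, so a(f) = ⟨a_0,…,a_{n-1}⟩ is finite
FiniteSeq : ℕ → (ℕ → ℕ) → Set
FiniteSeq a f = ∃[ n ] (∀ x → ¬ At a f n x)

module Submission where

-- The sequence a(f) starts with a and, if it continues at all, continues as
-- b(f ∘ suc), where b is the premise selected by f(0) (for an ω-inference b = {e}(f(0)), defined by totality);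
-- axioms and ∃-inferences end it at once. For this recursion to be sound, the successor of a must be determined
-- by the code a alone, which rests on injectivity of the tuple and program codings and determinism of evaluation.

open import Defs
open import Data.Nat using (ℕ; zero; suc; _+_; _<_; _≤_; _≡ᵇ_; s≤s; z≤n)
open import Data.Nat.Properties
open import Data.Nat.DivMod using (_%_)
open import Data.List using (List; []; _∷_)
open import Data.Bool using (true; false)
open import Data.Maybe.Properties using (just-injective)
open import Data.Product using (∃₂; _×_; _,_; proj₁; proj₂)
open import Data.Empty using (⊥-elim)
open import Function using (_∘_)
open import Relation.Binary.PropositionalEquality
open import Relation.Binary.Definitions using (tri<; tri≈; tri>)
open import Relation.Nullary using (¬_; contradiction)

tri-mono-≤ : ∀ {m n} → m ≤ n → tri m ≤ tri n
tri-mono-≤ z≤n       = z≤n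
tri-mono-≤ (s≤s m≤n) = +-mono-≤ (s≤s m≤n) (tri-mono-≤ m≤n)

pair-<-diagonal : ∀ x y x′ y′ → x + y < x′ + y′ → pair x y < pair x′ y′
pair-<-diagonal x y x′ y′ s<s′ = begin-strict
  tri (x + y) + y        ≤⟨ +-monoʳ-≤ (tri (x + y)) (m≤n+m y x) ⟩
  tri (x + y) + (x + y)  <⟨ s≤s (≤-reflexive (+-comm (tri (x + y)) (x + y))) ⟩
  tri (suc (x + y))      ≤⟨ tri-mono-≤ s<s′ ⟩
  tri (x′ + y′)          ≤⟨ m≤m+n (tri (x′ + y′)) y′ ⟩
  tri (x′ + y′) + y′     ∎
  where open ≤-Reasoning

pair-injective : ∀ {x y x′ y′} → pair x y ≡ pair x′ y′ → x ≡ x′ × y ≡ y′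
pair-injective {x} {y} {x′} {y′} p≡p′ with <-cmp (x + y) (x′ + y′)
... | tri< lt _ _ = contradiction p≡p′ (<⇒≢ (pair-<-diagonal x y x′ y′ lt))
... | tri> _ _ gt = contradiction p≡p′ (≢-sym (<⇒≢ (pair-<-diagonal x′ y′ x y gt)))
... | tri≈ _ s≡s′ _ = +-cancelʳ-≡ y x x′ (trans s≡s′ (cong (x′ +_) (sym y≡y′))) , y≡y′
  where
  y≡y′ : y ≡ y′
  y≡y′ = +-cancelˡ-≡ (tri (x + y)) y y′ (trans p≡p′ (cong (λ s → tri s + y′) (sym s≡s′)))

tup-injective : ∀ {xs ys} → tup xs ≡ tup ys → xs ≡ ys
tup-injective {[]}     {[]}     _   = refl
tup-injective {x ∷ xs} {y ∷ ys} t≡t′ with pair-injective {x} {tup xs} {y} {tup ys} (suc-injective t≡t′)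
... | refl , tail-eq = cong (x ∷_) (tup-injective tail-eq)

-- The graph of codePR, unfolded one tuple layer at a time, so that distinct program constructors are
-- told apart by the first component of their tuples.
mutual
  data Coded : PR → ℕ → Set where
    coded : ∀ {p xs c} → Layer p xs → tup xs ≡ c → Coded p c

  data CodedList : List PR → ℕ → Set where
    coded-list : ∀ {ps xs c} → ListLayer ps xs → tup xs ≡ c → CodedList ps c

  data Layer : PR → List ℕ → Set where
    layer-zero : Layer zeroF (0 ∷ [])
    layer-succ : Layer succF (1 ∷ [])
    layer-proj : ∀ {i} → Layer (proj i) (2 ∷ i ∷ [])
    layer-comp : ∀ {f gs m n} → Coded f m → CodedList gs n → Layer (comp f gs) (3 ∷ m ∷ n ∷ [])
    layer-prec : ∀ {f g m n} → Coded f m → Coded g n → Layer (prec f g) (4 ∷ m ∷ n ∷ [])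
    layer-mu   : ∀ {f m} → Coded f m → Layer (mu f) (5 ∷ m ∷ [])

  data ListLayer : List PR → List ℕ → Set where
    layer-[] : ListLayer [] []
    layer-∷  : ∀ {g gs m n} → Coded g m → CodedList gs n → ListLayer (g ∷ gs) (m ∷ n ∷ [])

mutual
  codePR-coded : ∀ p → Coded p (codePR p)
  codePR-coded zeroF       = coded layer-zero refl
  codePR-coded succF       = coded layer-succ refl
  codePR-coded (proj i)    = coded layer-proj refl
  codePR-coded (comp f gs) = coded (layer-comp (codePR-coded f) (codePRs-coded gs)) refl
  codePR-coded (prec f g)  = coded (layer-prec (codePR-coded f) (codePR-coded g)) refl
  codePR-coded (mu f)      = coded (layer-mu (codePR-coded f)) refl

  codePRs-coded : ∀ ps → CodedList ps (codePRs ps)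
  codePRs-coded []       = coded-list layer-[] refl
  codePRs-coded (g ∷ gs) = coded-list (layer-∷ (codePR-coded g) (codePRs-coded gs)) refl

mutual
  Coded-injective : ∀ {p q c} → Coded p c → Coded q c → p ≡ q
  Coded-injective (coded lp t≡c) (coded lq t′≡c) with tup-injective (trans t≡c (sym t′≡c))
  ... | refl = Layer-injective lp lq

  CodedList-injective : ∀ {ps qs c} → CodedList ps c → CodedList qs c → ps ≡ qs
  CodedList-injective (coded-list lp t≡c) (coded-list lq t′≡c) with tup-injective (trans t≡c (sym t′≡c))
  ... | refl = ListLayer-injective lp lq

  Layer-injective : ∀ {p q xs} → Layer p xs → Layer q xs → p ≡ q
  Layer-injective layer-zero          layer-zero            = refl
  Layer-injective layer-succ          layer-succ            = refl
  Layer-injective layer-proj          layer-proj            = refl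
  Layer-injective (layer-comp cf cgs) (layer-comp cf′ cgs′) =
    cong₂ comp (Coded-injective cf cf′) (CodedList-injective cgs cgs′)
  Layer-injective (layer-prec cf cg)  (layer-prec cf′ cg′)  =
    cong₂ prec (Coded-injective cf cf′) (Coded-injective cg cg′)
  Layer-injective (layer-mu cf)       (layer-mu cf′)        = cong mu (Coded-injective cf cf′)

  ListLayer-injective : ∀ {ps qs xs} → ListLayer ps xs → ListLayer qs xs → ps ≡ qs
  ListLayer-injective layer-[]         layer-[]           = refl
  ListLayer-injective (layer-∷ cg cgs) (layer-∷ cg′ cgs′) =
    cong₂ _∷_ (Coded-injective cg cg′) (CodedList-injective cgs cgs′)

codePR-injective : ∀ {p q} → codePR p ≡ codePR q → p ≡ q
codePR-injective {p} {q} c≡c′ = Coded-injective (codePR-coded p) (subst (Coded q) (sym c≡c′) (codePR-coded q))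

mutual
  Eval-deterministic : ∀ {p xs v w} → Eval p xs v → Eval p xs w → v ≡ w
  Eval-deterministic ev-zero           ev-zero             = refl
  Eval-deterministic ev-succ           ev-succ             = refl
  Eval-deterministic (ev-proj i↦v)     (ev-proj i↦w)       = just-injective (trans (sym i↦v) i↦w)
  Eval-deterministic (ev-comp gs↦ys f↦v) (ev-comp gs↦zs f↦w) with EvalList-deterministic gs↦ys gs↦zs
  ... | refl = Eval-deterministic f↦v f↦w
  Eval-deterministic (ev-prec0 f↦v)    (ev-prec0 f↦w)      = Eval-deterministic f↦v f↦w
  Eval-deterministic (ev-precS r↦ g↦v) (ev-precS r′↦ g↦w) with Eval-deterministic r↦ r′↦
  ... | refl = Eval-deterministic g↦v g↦w
  Eval-deterministic (ev-mu {n = n} root below) (ev-mu {n = n′} root′ below′) with <-cmp n n′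
  ... | tri≈ _ n≡n′ _ = n≡n′
  ... | tri< n<n′ _ _ = ⊥-elim (0≢1+n (Eval-deterministic root (proj₂ (below′ n n<n′))))
  ... | tri> _ _ n′<n = ⊥-elim (0≢1+n (Eval-deterministic root′ (proj₂ (below n′ n′<n))))

  EvalList-deterministic : ∀ {gs xs ys zs} → EvalList gs xs ys → EvalList gs xs zs → ys ≡ zs
  EvalList-deterministic evl-[]          evl-[]            = refl
  EvalList-deterministic (evl-∷ g↦y gs↦ys) (evl-∷ g↦z gs↦zs) =
    cong₂ _∷_ (Eval-deterministic g↦y g↦z) (EvalList-deterministic gs↦ys gs↦zs)

·≃-functional : ∀ {e n m m′} → e · n ≃ m → e · n ≃ m′ → m ≡ m′
·≃-functional (p , p↦e , p↦m) (p′ , p′↦e , p′↦m′) with codePR-injective {p} {p′} (trans p↦e (sym p′↦e))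
... | refl = Eval-deterministic p↦m p′↦m′

pick-elim : ∀ {P : ℕ → Set} k {b₀ b₁} → P b₀ → P b₁ → P (pick k b₀ b₁)
pick-elim k pb₀ pb₁ with (k % 2) ≡ᵇ 0
... | true  = pb₀
... | false = pb₁

-- The formula component is left
-- unconstrained: formula codes are not constructor terms, so constraining it would block inversion by unification.
data Step (k : ℕ) : List ℕ → ℕ → Set where
  step-and : ∀ {Γ F b₀ b₁} → Step k (tAnd ∷ Γ ∷ F ∷ b₀ ∷ b₁ ∷ []) (pick k b₀ b₁)
  step-cut : ∀ {Γ F b₀ b₁} → Step k (tCut ∷ Γ ∷ F ∷ b₀ ∷ b₁ ∷ []) (pick k b₀ b₁)
  step-or  : ∀ {Γ F b} → Step k (tOr ∷ Γ ∷ F ∷ b ∷ []) b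
  step-ω   : ∀ {Γ F e m} → e · k ≃ m → Step k (tω ∷ Γ ∷ F ∷ e ∷ []) m

At-suc⁻ : ∀ {a f i x} → At a f (suc i) x →
          ∃₂ λ xs c → a ≡ tup xs × Step (f 0) xs c × At c (f ∘ suc) i x
At-suc⁻ {i = zero} (at-and {Γ = Γ} {A} {B} {b₀} {b₁} at-0) =
  tAnd ∷ Γ ∷ ⌜ and A B ⌝ ∷ b₀ ∷ b₁ ∷ [] , _ , refl , step-and , at-0
At-suc⁻ {i = zero} (at-cut {Γ = Γ} {C} {b₀} {b₁} at-0) =
  tCut ∷ Γ ∷ ⌜ C ⌝ ∷ b₀ ∷ b₁ ∷ [] , _ , refl , step-cut , at-0
At-suc⁻ {i = zero} (at-or {Γ = Γ} {A} {B} {b} at-0) =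
  tOr ∷ Γ ∷ ⌜ or A B ⌝ ∷ b ∷ [] , _ , refl , step-or , at-0
At-suc⁻ {i = zero} (at-ω {Γ = Γ} {A} {e} at-0 e↦m) =
  tω ∷ Γ ∷ ⌜ all A ⌝ ∷ e ∷ [] , _ , refl , step-ω e↦m , at-0
At-suc⁻ {i = suc i} (at-and {Γ = Γ} {A} {B} {b₀} {b₁} a↦) with At-suc⁻ a↦
... | xs , c , a≡ , s , c↦ = xs , c , a≡ , s , at-and {Γ = Γ} {A} {B} {b₀} {b₁} c↦
At-suc⁻ {i = suc i} (at-cut {Γ = Γ} {C} {b₀} {b₁} a↦) with At-suc⁻ a↦
... | xs , c , a≡ , s , c↦ = xs , c , a≡ , s , at-cut {Γ = Γ} {C} {b₀} {b₁} c↦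
At-suc⁻ {i = suc i} (at-or {Γ = Γ} {A} {B} {b} a↦) with At-suc⁻ a↦
... | xs , c , a≡ , s , c↦ = xs , c , a≡ , s , at-or {Γ = Γ} {A} {B} {b} c↦
At-suc⁻ {i = suc i} (at-ω {Γ = Γ} {A} {e} a↦ e↦m) with At-suc⁻ a↦
... | xs , c , a≡ , s , c↦ = xs , c , a≡ , s , at-ω {Γ = Γ} {A} {e} c↦ e↦m

Halts : ℕ → (ℕ → ℕ) → ℕ → Set
Halts a f n = ∀ x → ¬ At a f n x

halts-after-step : ∀ ys {f n} → (∀ {c} → Step (f 0) ys c → Halts c (f ∘ suc) n) → Halts (tup ys) f (suc n)
halts-after-step ys halts x a↦x with At-suc⁻ a↦x
... | xs , c , ys≡xs , s , c↦x with tup-injective {ys} {xs} ys≡xs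
... | refl = halts s x c↦x

Crec⇒finiteSeq : ∀ {a} → Crec a → ∀ f → FiniteSeq a f
Crec⇒finiteSeq (c-ax {Γ} _) f = 1 , halts-after-step (tAx ∷ Γ ∷ []) {n = 0} λ ()
Crec⇒finiteSeq (c-ex {Γ} {A} {a} _ _ _) f = 1 , halts-after-step (tEx ∷ Γ ∷ ⌜ ex A ⌝ ∷ a ∷ []) {n = 0} λ ()
Crec⇒finiteSeq (c-or {Γ} {A} {B} {a} ca _) f =
  let n , halts = Crec⇒finiteSeq ca (f ∘ suc)
  in suc n , halts-after-step (tOr ∷ Γ ∷ ⌜ or A B ⌝ ∷ a ∷ []) λ { step-or → halts }
Crec⇒finiteSeq (c-and {Γ} {A} {B} {a} {b} ca cb _ _) f =
  let n , halts = pick-elim {λ c → FiniteSeq c (f ∘ suc)} (f 0)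
                    (Crec⇒finiteSeq ca (f ∘ suc)) (Crec⇒finiteSeq cb (f ∘ suc))
  in suc n , halts-after-step (tAnd ∷ Γ ∷ ⌜ and A B ⌝ ∷ a ∷ b ∷ []) λ { step-and → halts }
Crec⇒finiteSeq (c-cut {Γ} {C} {a} {b} ca cb _ _) f =
  let n , halts = pick-elim {λ c → FiniteSeq c (f ∘ suc)} (f 0)
                    (Crec⇒finiteSeq ca (f ∘ suc)) (Crec⇒finiteSeq cb (f ∘ suc))
  in suc n , halts-after-step (tCut ∷ Γ ∷ ⌜ C ⌝ ∷ a ∷ b ∷ []) λ { step-cut → halts }
Crec⇒finiteSeq (c-ω {Γ} {A} {e} total premises) f =
  let m , e↦m = total (f 0)
      n , halts = Crec⇒finiteSeq (proj₁ (premises (f 0) m e↦m)) (f ∘ suc)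
  in suc n , halts-after-step (tω ∷ Γ ∷ ⌜ all A ⌝ ∷ e ∷ []) λ
       { (step-ω e↦m′) → subst (λ c → Halts c (f ∘ suc) n) (·≃-functional e↦m e↦m′) halts }

lemma3p7 : ∀ (a : ℕ) → Crec a → (f : ℕ → ℕ) → FiniteSeq a f
lemma3p7 a ca f = Crec⇒finiteSeq ca f
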